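{- A connected graph $G$ of order $n\geq 3$ satisfies $\Gamma_t(G)=n-1$ if and only if $n$ is odd and $G$ is obtained from $\frac{n-1}{2}K_2$ (the disjoint union of $\frac{n-1}{2}$ copies of $K_2$) by joining a new vertex to at least one vertex of each $K_2$.
   Context: A total dominating set (TDS) of a graph $G$ without isolated vertices is a set $S\subseteq V(G)$ such that every vertex of $G$ is adjacent to a vertex of $S$. A minimal TDS (MTDS) is a TDS no proper subset of which is a TDS. The upper total domination number $\Gamma_t(G)$ is the maximum cardinality of an MTDS of $G$. -}

module Defs where

open import Data.Nat using (ℕ; zero; suc; _+_; _∸_; _≤_)
open import Data.Fin using (Fin)
open import Data.Fin.Subset using (Subset; _∈_; _⊂_; ∣_∣)
open import Data.Bool using (Bool; T; not)
open import Data.Maybe using (Maybe; just; nothing)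
open import Data.Product using (Σ; ∃; ∃-syntax; _×_; _,_)
open import Data.Sum using (_⊎_)
open import Data.Empty using (⊥)
open import Data.Unit using (⊤)
open import Relation.Nullary using (¬_; Dec)
open import Relation.Binary.PropositionalEquality using (_≡_)
open import Function.Bundles using (_⤖_; Bijection)

record Graph (n : ℕ) : Set₁ where
  field
    Adj    : Fin n → Fin n → Set
    adj?   : ∀ u v → Dec (Adj u v)
    sym    : ∀ {u v} → Adj u v → Adj v u
    irrefl : ∀ {u} → ¬ Adj u u
open Graph public

data Walk {n : ℕ} (G : Graph n) : Fin n → Fin n → Set where
  here : ∀ {u} → Walk G u u
  step : ∀ {u w v} → Adj G u w → Walk G w v → Walk G u v

Connected : {n : ℕ} → Graph n → Set
Connected G = ∀ u v → Walk G u v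

IsTDS : {n : ℕ} → Graph n → Subset n → Set
IsTDS G S = ∀ v → ∃[ u ] (u ∈ S × Adj G v u)

IsMTDS : {n : ℕ} → Graph n → Subset n → Set
IsMTDS G S = IsTDS G S × (∀ T → T ⊂ S → ¬ IsTDS G T)

UpperTotalDomNumberIs : {n : ℕ} → Graph n → ℕ → Set
UpperTotalDomNumberIs G k =
  (∃[ S ] (IsMTDS G S × ∣ S ∣ ≡ k)) × (∀ S → IsMTDS G S → ∣ S ∣ ≤ k)

-- The graph obtained from k K_2 by joining a new vertex to at least one
-- vertex of each K_2.  Vertices: nothing = the new vertex,
-- just (i , b) = endpoint b of the i-th copy of K_2.  J i b says that the
-- new vertex is joined to endpoint b of copy i.
StarAdj : (k : ℕ) → (Fin k → Bool → Bool) →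
          Maybe (Fin k × Bool) → Maybe (Fin k × Bool) → Set
StarAdj k J nothing nothing = ⊥
StarAdj k J nothing (just (i , b)) = T (J i b)
StarAdj k J (just (i , b)) nothing = T (J i b)
StarAdj k J (just (i , b)) (just (j , c)) = (i ≡ j) × (c ≡ not b)

JoinsEach : (k : ℕ) → (Fin k → Bool → Bool) → Set
JoinsEach k J = ∀ i → ∃[ b ] T (J i b)

IsJoinedMatching : {n : ℕ} → Graph n → ℕ → Set
IsJoinedMatching {n} G k =
  ∃[ J ] (JoinsEach k J ×
    Σ (Fin n ⤖ Maybe (Fin k × Bool)) λ φ →
      ∀ u v → (Adj G u v → StarAdj k J (Bijection.to φ u) (Bijection.to φ v))
            × (StarAdj k J (Bijection.to φ u) (Bijection.to φ v) → Adj G u v))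

Odd : ℕ → Set
Odd n = ∃[ m ] (n ≡ suc (m + m))

module Submission where

-- Both directions pass through one notion: G − x is a perfect matching
-- (PerfectMatchingMinus).
-- Then:
--   A. an MTDS of size n - 1 is V ∖ {x}, and G − x is a perfect matching: the
--      n - 1 private neighbours are distinct, leaving no room for a vertex of
--      V ∖ {x} with two neighbours in V ∖ {x};
--   B. if G − x is a perfect matching and G is connected, G is a joined matching;
--   C. a joined matching minus its new vertex is a perfect matching;
--   D. if G − x is a perfect matching, V ∖ {x} is an MTDS, of the maximum
--      size n - 1 because V itself is not minimal.

open import Defs
open import Data.Nat using (ℕ; zero; suc; _+_; _*_; _∸_; _≤_; _<_; _/_; s≤s; z≤n)
open import Data.Nat.Properties using (<-irrefl; 1+n≰n; ≤-pred; +-suc; *-suc; *-identityʳ)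
open import Data.Nat.DivMod using (m*n/n≡m)
open import Data.Fin using (Fin; zero; suc; punchIn; punchOut)
open import Data.Fin.Properties
  using (_≟_; suc-injective; any?; all?; ¬∀⟶∃¬; injective⇒≤; punchIn-injective; punchInᵢ≢i;
         punchOut-injective; punchOut-cong; punchOut-punchIn; punchIn-punchOut)
open import Data.Fin.Subset using (Subset; _∈_; _∉_; _⊂_; ∣_∣; ⊤; ∁; ⁅_⁆; _-_)
open import Data.Fin.Subset.Properties
  using (_∈?_; ∈⊤; ∣⊤∣≡n; p⊂q⇒∣p∣<∣q∣; p⊆q⇒∣p∣≤∣q∣; ∣∁p∣≡n∸∣p∣; ∣⁅x⁆∣≡1;
         x∉p⇒x∈∁p; x∈∁p⇒x∉p; x≢y⇒x∉⁅y⁆; x∈⁅x⁆; x∈p⇒p-x⊂p; x∈p∧x≢y⇒x∈p-y)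
open import Data.Bool using (Bool; true; false; not; T)
open import Data.Maybe using (Maybe; just; nothing)
open import Data.Product using (∃-syntax; ∃₂; _×_; _,_; proj₁; proj₂; map₁)
open import Data.Sum using (_⊎_; inj₁; inj₂)
open import Data.Empty using (⊥-elim)
open import Relation.Nullary using (¬_; Dec; yes; no)
open import Relation.Nullary.Decidable using (_×-dec_; _⊎-dec_; isYes; fromWitness; toWitness)
open import Relation.Binary.PropositionalEquality
  using (_≡_; _≢_; refl; trans; cong; subst; subst₂; module ≡-Reasoning)
  renaming (sym to ≡-sym)
open import Function.Definitions using (Injective)
open import Function.Bundles using (_⇔_; mk⇔; _⤖_; Bijection; mk↔ₛ′)
open import Function.Properties.Inverse using (↔⇒⤖)

opposite : ∀ {k} → Fin k × Bool → Fin k × Bool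
opposite (i , b) = (i , not b)

record Pairing {m : ℕ} (q : Fin m → Fin m) : Set where
  field
    pairs         : ℕ
    size          : m ≡ pairs + pairs
    label         : Fin m → Fin pairs × Bool
    unlabel       : Fin pairs × Bool → Fin m
    label-unlabel : ∀ y → label (unlabel y) ≡ y
    unlabel-label : ∀ v → unlabel (label v) ≡ v
    label-q       : ∀ v → label (q v) ≡ opposite (label v)

module RemovePair {m : ℕ} (t : Fin (suc m)) where

  embed : Fin m → Fin (suc (suc m))
  embed v = suc (punchIn t v)

  embed-injective : ∀ {v w} → embed v ≡ embed w → v ≡ w
  embed-injective {v} {w} eq = punchIn-injective t v w (suc-injective eq)

  data Position : Fin (suc (suc m)) → Set where
    first  : Position zero
    second : Position (suc t)
    rest   : ∀ v → Position (embed v)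

  position : ∀ x → Position x
  position zero = first
  position (suc y) with t ≟ y
  ... | yes refl = second
  ... | no t≢y   = subst Position (cong suc (punchIn-punchOut t≢y)) (rest (punchOut t≢y))

  rest≢second : ∀ v → embed v ≢ suc t
  rest≢second v eq = punchInᵢ≢i t v (suc-injective eq)

  remaining : ∀ {x} → Position x → x ≢ zero → x ≢ suc t → ∃[ w ] x ≡ embed w
  remaining first  x≢0 _   = ⊥-elim (x≢0 refl)
  remaining second _   x≢t = ⊥-elim (x≢t refl)
  remaining (rest w) _ _   = w , refl

  module Restrict (q : Fin (suc (suc m)) → Fin (suc (suc m)))
                  (involutive : ∀ x → q (q x) ≡ x) (q-first : q zero ≡ suc t) where
    open ≡-Reasoning

    q-second : q (suc t) ≡ zero
    q-second = trans (cong q (≡-sym q-first)) (involutive zero)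

    q-rest : ∀ v → ∃[ w ] q (embed v) ≡ embed w
    q-rest v = remaining (position (q (embed v))) hit-first hit-second
      where
        swap-side : ∀ {y} → q (embed v) ≡ y → embed v ≡ q y
        swap-side eq = trans (≡-sym (involutive (embed v))) (cong q eq)
        hit-first : q (embed v) ≢ zero
        hit-first eq = rest≢second v (trans (swap-side eq) q-first)
        hit-second : q (embed v) ≢ suc t
        hit-second eq with trans (swap-side eq) q-second
        ... | ()

    restricted : Fin m → Fin m
    restricted v = proj₁ (q-rest v)

    embed-restricted : ∀ v → embed (restricted v) ≡ q (embed v)
    embed-restricted v = ≡-sym (proj₂ (q-rest v))

    restricted-involutive : ∀ v → restricted (restricted v) ≡ v
    restricted-involutive v = embed-injective (begin
      embed (restricted (restricted v)) ≡⟨ embed-restricted (restricted v) ⟩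
      q (embed (restricted v))          ≡⟨ cong q (embed-restricted v) ⟩
      q (q (embed v))                   ≡⟨ involutive (embed v) ⟩
      embed v                           ∎)

    restricted-fixpoint-free : (∀ x → q x ≢ x) → ∀ v → restricted v ≢ v
    restricted-fixpoint-free fixpoint-free v eq =
      fixpoint-free (embed v) (trans (≡-sym (embed-restricted v)) (cong embed eq))

    module Extend (P : Pairing restricted) where
      open Pairing P renaming (pairs to k; label to label′; unlabel to unlabel′;
        label-unlabel to label-unlabel′; unlabel-label to unlabel-label′; label-q to label-q′)

      label : Fin (suc (suc m)) → Fin (suc k) × Bool
      label zero = (zero , false)
      label (suc y) with t ≟ y
      ... | yes _   = (zero , true)
      ... | no t≢y  = map₁ suc (label′ (punchOut t≢y))

      unlabel : Fin (suc k) × Bool → Fin (suc (suc m))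
      unlabel (zero , false) = zero
      unlabel (zero , true)  = suc t
      unlabel (suc i , b)    = embed (unlabel′ (i , b))

      label-second : label (suc t) ≡ (zero , true)
      label-second with t ≟ t
      ... | yes _  = refl
      ... | no t≢t = ⊥-elim (t≢t refl)

      label-rest : ∀ v → label (embed v) ≡ map₁ suc (label′ v)
      label-rest v with t ≟ punchIn t v
      ... | yes t≡ = ⊥-elim (punchInᵢ≢i t v (≡-sym t≡))
      ... | no t≢  = cong (λ w → map₁ suc (label′ w)) (trans (punchOut-cong t refl) (punchOut-punchIn t))

      label-unlabel : ∀ y → label (unlabel y) ≡ y
      label-unlabel (zero , false) = refl
      label-unlabel (zero , true)  = label-second
      label-unlabel (suc i , b)    =
        trans (label-rest (unlabel′ (i , b))) (cong (map₁ suc) (label-unlabel′ (i , b)))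

      unlabel-label : ∀ x → unlabel (label x) ≡ x
      unlabel-label x with position x
      ... | first  = refl
      ... | second = cong unlabel label-second
      ... | rest v = trans (cong unlabel (label-rest v)) (cong embed (unlabel-label′ v))

      label-q : ∀ x → label (q x) ≡ opposite (label x)
      label-q x with position x
      ... | first  = trans (cong label q-first) label-second
      ... | second = trans (cong label q-second) (cong opposite (≡-sym label-second))
      ... | rest v = begin
        label (q (embed v))             ≡⟨ cong label (≡-sym (embed-restricted v)) ⟩
        label (embed (restricted v))    ≡⟨ label-rest (restricted v) ⟩
        map₁ suc (label′ (restricted v)) ≡⟨ cong (map₁ suc) (label-q′ v) ⟩
        map₁ suc (opposite (label′ v))  ≡⟨ cong opposite (≡-sym (label-rest v)) ⟩
        opposite (label (embed v))      ∎

      extended : Pairing q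
      extended = record
        { pairs = suc k ; size = cong suc (trans (cong suc size) (≡-sym (+-suc k k)))
        ; label = label ; unlabel = unlabel ; label-unlabel = label-unlabel
        ; unlabel-label = unlabel-label ; label-q = label-q }

-- Every fixed-point-free involution of Fin m admits a pairing (so m is even):
-- pair zero with q zero and recurse on the remaining m - 2 points.
involution-pairing : ∀ m (q : Fin m → Fin m) →
  (∀ x → q (q x) ≡ x) → (∀ x → q x ≢ x) → Pairing q
involution-pairing zero q _ _ = record
  { pairs = 0 ; size = refl ; label = λ () ; unlabel = λ { (() , _) }
  ; label-unlabel = λ { (() , _) } ; unlabel-label = λ () ; label-q = λ () }
involution-pairing (suc zero) q _ fixpoint-free with q zero in q-zero
... | zero = ⊥-elim (fixpoint-free zero q-zero)
involution-pairing (suc (suc m)) q involutive fixpoint-free with q zero in q-zero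
... | zero  = ⊥-elim (fixpoint-free zero q-zero)
... | suc t = Extend.extended (involution-pairing m restricted restricted-involutive
                                (restricted-fixpoint-free fixpoint-free))
  where open RemovePair t
        open Restrict q involutive q-zero

≢⇒∈∁⁅⁆ : ∀ {n} {v x : Fin n} → v ≢ x → v ∈ ∁ ⁅ x ⁆
≢⇒∈∁⁅⁆ v≢x = x∉p⇒x∈∁p (x≢y⇒x∉⁅y⁆ v≢x)

∈∁⁅⁆⇒≢ : ∀ {n} {v x : Fin n} → v ∈ ∁ ⁅ x ⁆ → v ≢ x
∈∁⁅⁆⇒≢ v∈ refl = x∈∁p⇒x∉p v∈ (x∈⁅x⁆ _)

∣∁⁅x⁆∣ : ∀ {m} (x : Fin (suc m)) → ∣ ∁ ⁅ x ⁆ ∣ ≡ m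
∣∁⁅x⁆∣ {m} x = trans (∣∁p∣≡n∸∣p∣ ⁅ x ⁆) (cong (suc m ∸_) (∣⁅x⁆∣≡1 x))

all-but-one : ∀ {m} (S : Subset (suc m)) → ∣ S ∣ ≡ m →
  ∃[ x ] (x ∉ S × ∀ y → y ≢ x → y ∈ S)
all-but-one {m} S size with all? (_∈? S)
... | yes everything = ⊥-elim (1+n≰n (subst₂ _≤_ (∣⊤∣≡n (suc m)) size
                         (p⊆q⇒∣p∣≤∣q∣ {p = ⊤} {q = S} (λ {v} _ → everything v))))
... | no ¬everything with ¬∀⟶∃¬ _ (_∈ S) (_∈? S) ¬everything
... | x , x∉S = x , x∉S , others
  where
    others : ∀ y → y ≢ x → y ∈ S
    others y y≢x with y ∈? S
    ... | yes y∈S = y∈S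
    ... | no y∉S  = ⊥-elim (<-irrefl refl (subst₂ _<_ size (∣∁⁅x⁆∣ x) (p⊂q⇒∣p∣<∣q∣ S⊂V∖x)))
      where
        S⊂V∖x : S ⊂ ∁ ⁅ x ⁆
        S⊂V∖x = (λ {u} u∈S → ≢⇒∈∁⁅⁆ (λ { refl → x∉S u∈S })) , y , ≢⇒∈∁⁅⁆ y≢x , y∉S

injective⇒surjective : ∀ {m} (f : Fin m → Fin m) → Injective _≡_ _≡_ f →
  ∀ y → ∃[ i ] f i ≡ y
injective⇒surjective {suc m} f f-inj y with any? (λ i → f i ≟ y)
... | yes hit = hit
... | no miss = ⊥-elim (1+n≰n (injective⇒≤ f′-inj))
  where
    f≢y : ∀ i → y ≢ f i
    f≢y i y≡fi = miss (i , ≡-sym y≡fi)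
    f′ : Fin (suc m) → Fin m
    f′ i = punchOut (f≢y i)
    f′-inj : Injective _≡_ _≡_ f′
    f′-inj {i} {j} eq = f-inj (punchOut-injective (f≢y i) (f≢y j) eq)

injection-covers : ∀ {m} (f : Fin m → Fin (suc m)) {w : Fin (suc m)} →
  Injective _≡_ _≡_ f → (∀ i → f i ≢ w) → ∀ c → c ≢ w → ∃[ i ] f i ≡ c
injection-covers {m} f {w} f-inj avoids c c≢w =
  let (i , eq) = injective⇒surjective f′ f′-inj (punchOut (w≢ c≢w))
  in i , punchOut-injective (w≢ (avoids i)) (w≢ c≢w) eq
  where
    w≢ : ∀ {u} → u ≢ w → w ≢ u
    w≢ u≢w w≡u = u≢w (≡-sym w≡u)
    f′ : Fin m → Fin m
    f′ i = punchOut (w≢ (avoids i))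
    f′-inj : Injective _≡_ _≡_ f′
    f′-inj {i} {j} eq = f-inj (punchOut-injective (w≢ (avoids i)) (w≢ (avoids j)) eq)

PrivateNeighbour : ∀ {n} → Graph n → Subset n → Fin n → Fin n → Set
PrivateNeighbour G S v w = Adj G w v × (∀ u → u ∈ S → Adj G w u → u ≡ v)

-- Every vertex v of an MTDS S has a private neighbour: S - v is not a TDS,
-- so some vertex w has no neighbour in S - v, yet w has one in S.
mtds⇒private : ∀ {n} (G : Graph n) {S : Subset n} → IsMTDS G S →
  ∀ {v} → v ∈ S → ∃[ w ] PrivateNeighbour G S v w
mtds⇒private {n} G {S} (tds , minimal) {v} v∈S = w , adjacent , only
  where
    dominated? : ∀ w → Dec (∃[ u ] (u ∈ S - v × Adj G w u))
    dominated? w = any? (λ u → (u ∈? (S - v)) ×-dec adj? G w u)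
    undominated : ∃[ w ] ¬ (∃[ u ] (u ∈ S - v × Adj G w u))
    undominated = ¬∀⟶∃¬ n _ dominated? (minimal (S - v) (x∈p⇒p-x⊂p v∈S))
    w : Fin n
    w = proj₁ undominated
    only : ∀ u → u ∈ S → Adj G w u → u ≡ v
    only u u∈S a with u ≟ v
    ... | yes u≡v = u≡v
    ... | no u≢v  = ⊥-elim (proj₂ undominated (u , x∈p∧x≢y⇒x∈p-y u∈S u≢v , a))
    adjacent : Adj G w v
    adjacent = let (u , u∈S , a) = tds w in subst (Adj G w) (only u u∈S a) a

-- Conversely, if every vertex of S has a private neighbour then no proper
-- subset T of S is a TDS: a vertex of S ∖ T leaves its private neighbour undominated.
private⇒minimal : ∀ {n} (G : Graph n) {S : Subset n} →
  (∀ {v} → v ∈ S → ∃[ w ] PrivateNeighbour G S v w) → ∀ T → T ⊂ S → ¬ IsTDS G T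
private⇒minimal G has-private T (T⊆S , v , v∈S , v∉T) tdsT =
  let (w , _ , only) = has-private v∈S
      (u , u∈T , a)  = tdsT w
  in v∉T (subst (_∈ T) (only u (T⊆S u∈T) a) u∈T)

-- If some TDS omits a vertex then V itself is not minimal, so every MTDS
-- has at most n - 1 vertices.
mtds-size-bound : ∀ {m} (G : Graph (suc m)) {T : Subset (suc m)} → IsTDS G T →
  ∃[ z ] z ∉ T → ∀ S → IsMTDS G S → ∣ S ∣ ≤ m
mtds-size-bound {m} G {T} tdsT (z , z∉T) S (_ , minimal) with all? (_∈? S)
... | yes everything = ⊥-elim (minimal T ((λ {u} _ → everything u) , z , everything z , z∉T) tdsT)
... | no ¬everything with ¬∀⟶∃¬ _ (_∈ S) (_∈? S) ¬everything
... | y , y∉S = ≤-pred (subst (∣ S ∣ <_) (∣⊤∣≡n (suc m))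
                  (p⊂q⇒∣p∣<∣q∣ {p = S} {q = ⊤} ((λ _ → ∈⊤) , y , ∈⊤ , y∉S)))

walk-exits : ∀ {n} (G : Graph n) {M : Fin n → Set} → (∀ v → Dec (M v)) →
  ∀ {u y} → Walk G u y → M u → ¬ M y → ∃₂ λ a b → M a × ¬ M b × Adj G a b
walk-exits G M? here            Mu ¬My = ⊥-elim (¬My Mu)
walk-exits G M? (step {w = w} a rest) Mu ¬My with M? w
... | yes Mw  = walk-exits G M? rest Mw ¬My
... | no ¬Mw  = _ , w , Mu , ¬Mw , a

connected⇒neighbour : ∀ {n} (G : Graph n) → Connected G → ∀ u v → v ≢ u → ∃[ w ] Adj G u w
connected⇒neighbour G connected u v v≢u =
  let (a , w , a≡u , _ , adj) = walk-exits G (_≟ u) (connected u v) refl v≢u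
  in w , subst (λ a → Adj G a w) a≡u adj

PerfectMatchingMinus : ∀ {n} → Graph n → Fin n → Set
PerfectMatchingMinus G x = ∀ v → v ≢ x →
  ∃[ u ] (u ≢ x × Adj G v u × ∀ w → w ≢ x → Adj G v w → w ≡ u)

-- Each vertex of S has a neighbour in S; it has at most one, since otherwise
-- it is no private neighbour, so the n - 1 distinct private neighbours
-- are all the other vertices, including its two S-neighbours,
-- whose owners both have to be that vertex.
large-mtds⇒matching : ∀ {m} (G : Graph (suc m)) (S : Subset (suc m)) →
  IsMTDS G S → ∣ S ∣ ≡ m → ∃[ x ] PerfectMatchingMinus G x
large-mtds⇒matching {m} G S mtds size = x , matching
  where
    x : Fin (suc m)
    x = proj₁ (all-but-one S size)
    x∉S : x ∉ S
    x∉S = proj₁ (proj₂ (all-but-one S size))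
    ≢x⇒∈S : ∀ {u} → u ≢ x → u ∈ S
    ≢x⇒∈S = proj₂ (proj₂ (all-but-one S size)) _
    ∈S⇒≢x : ∀ {u} → u ∈ S → u ≢ x
    ∈S⇒≢x u∈S refl = x∉S u∈S

    P : Fin m → Fin (suc m)
    P = punchIn x
    private-of : ∀ i → ∃[ w ] PrivateNeighbour G S (P i) w
    private-of i = mtds⇒private G mtds (≢x⇒∈S (punchInᵢ≢i x i))
    priv : Fin m → Fin (suc m)
    priv i = proj₁ (private-of i)
    priv-only : ∀ i u → u ≢ x → Adj G (priv i) u → u ≡ P i
    priv-only i u u≢x = proj₂ (proj₂ (private-of i)) u (≢x⇒∈S u≢x)
    priv-injective : Injective _≡_ _≡_ priv
    priv-injective {i} {j} eq = punchIn-injective x i j (≡-sym (priv-only i (P j) (punchInᵢ≢i x j)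
      (subst (λ w → Adj G w (P j)) (≡-sym eq) (proj₁ (proj₂ (private-of j))))))

    at-most-one : ∀ w → w ≢ x → ∀ a b → a ≢ x → b ≢ x → Adj G w a → Adj G w b → a ≡ b
    at-most-one w w≢x a b a≢x b≢x wa wb with any? (λ i → priv i ≟ w)
    ... | yes (i , refl) = trans (priv-only i a a≢x wa) (≡-sym (priv-only i b b≢x wb))
    ... | no not-private =
      let (i , priv-i≡a , P-i≡w) = owner a wa
          (j , priv-j≡b , P-j≡w) = owner b wb
          i≡j = punchIn-injective x i j (trans P-i≡w (≡-sym P-j≡w))
      in trans (≡-sym priv-i≡a) (trans (cong priv i≡j) priv-j≡b)
      where
        owner : ∀ c → Adj G w c → ∃[ i ] (priv i ≡ c × P i ≡ w)
        owner c wc =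
          let (i , priv-i≡c) = injection-covers priv priv-injective
                                 (λ i e → not-private (i , e)) c (λ { refl → irrefl G wc })
          in i , priv-i≡c , ≡-sym (priv-only i w w≢x
               (subst (λ z → Adj G z w) (≡-sym priv-i≡c) (sym G wc)))

    matching : PerfectMatchingMinus G x
    matching v v≢x =
      let (u , u∈S , vu) = proj₁ mtds v
      in u , ∈S⇒≢x u∈S , vu , λ w w≢x vw → at-most-one v v≢x w u w≢x (∈S⇒≢x u∈S) vw vu

-- If G − x is a perfect matching then G is the graph obtained from k K₂ by
-- joining x to some endpoints, where the matching edges of G − x are the
-- copies of K₂; if G is connected, x is joined to every copy.
module MatchingPlusVertex {m : ℕ} (G : Graph (suc m)) (x : Fin (suc m))
                          (matching : PerfectMatchingMinus G x) where
  open ≡-Reasoning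

  P : Fin m → Fin (suc m)
  P = punchIn x

  P≢x : ∀ i → P i ≢ x
  P≢x i = punchInᵢ≢i x i

  matched : ∀ i → Fin (suc m)
  matched i = proj₁ (matching (P i) (P≢x i))

  x≢matched : ∀ i → x ≢ matched i
  x≢matched i x≡ = proj₁ (proj₂ (matching (P i) (P≢x i))) (≡-sym x≡)

  partner : Fin m → Fin m
  partner i = punchOut (x≢matched i)

  partner-adj : ∀ i → Adj G (P i) (P (partner i))
  partner-adj i = subst (Adj G (P i)) (≡-sym (punchIn-punchOut (x≢matched i)))
                        (proj₁ (proj₂ (proj₂ (matching (P i) (P≢x i)))))

  partner-unique : ∀ i j → Adj G (P i) (P j) → j ≡ partner i
  partner-unique i j adj = punchIn-injective x j (partner i)
    (trans (proj₂ (proj₂ (proj₂ (matching (P i) (P≢x i)))) (P j) (P≢x j) adj)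
           (≡-sym (punchIn-punchOut (x≢matched i))))

  partner-involutive : ∀ i → partner (partner i) ≡ i
  partner-involutive i = ≡-sym (partner-unique (partner i) i (sym G (partner-adj i)))

  partner-fixpoint-free : ∀ i → partner i ≢ i
  partner-fixpoint-free i eq = irrefl G (subst (λ j → Adj G (P i) (P j)) eq (partner-adj i))

  open Pairing (involution-pairing m partner partner-involutive partner-fixpoint-free) public

  partner-label : ∀ y y′ → unlabel y′ ≡ partner (unlabel y) → y′ ≡ opposite y
  partner-label y y′ eq = begin
    y′                                ≡⟨ ≡-sym (label-unlabel y′) ⟩
    label (unlabel y′)                ≡⟨ cong label eq ⟩
    label (partner (unlabel y))       ≡⟨ label-q (unlabel y) ⟩
    opposite (label (unlabel y))      ≡⟨ cong opposite (label-unlabel y) ⟩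
    opposite y                        ∎

  unlabel-opposite : ∀ y → unlabel (opposite y) ≡ partner (unlabel y)
  unlabel-opposite y = begin
    unlabel (opposite y)                        ≡⟨ cong (λ z → unlabel (opposite z)) (≡-sym (label-unlabel y)) ⟩
    unlabel (opposite (label (unlabel y)))      ≡⟨ cong unlabel (≡-sym (label-q (unlabel y))) ⟩
    unlabel (label (partner (unlabel y)))       ≡⟨ unlabel-label (partner (unlabel y)) ⟩
    partner (unlabel y)                         ∎

  from : Maybe (Fin pairs × Bool) → Fin (suc m)
  from nothing  = x
  from (just y) = P (unlabel y)

  to : Fin (suc m) → Maybe (Fin pairs × Bool)
  to v with x ≟ v
  ... | yes _   = nothing
  ... | no x≢v  = just (label (punchOut x≢v))

  to-from : ∀ y → to (from y) ≡ y
  to-from nothing with x ≟ x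
  ... | yes _   = refl
  ... | no x≢x  = ⊥-elim (x≢x refl)
  to-from (just y) with x ≟ P (unlabel y)
  ... | yes x≡  = ⊥-elim (P≢x (unlabel y) (≡-sym x≡))
  ... | no x≢   = cong just (trans (cong label (trans (punchOut-cong x refl) (punchOut-punchIn x)))
                                   (label-unlabel y))

  from-to : ∀ v → from (to v) ≡ v
  from-to v with x ≟ v
  ... | yes x≡v = x≡v
  ... | no x≢v  = trans (cong P (unlabel-label (punchOut x≢v))) (punchIn-punchOut x≢v)

  J : Fin pairs → Bool → Bool
  J i b = isYes (adj? G x (from (just (i , b))))

  Star : Maybe (Fin pairs × Bool) → Maybe (Fin pairs × Bool) → Set
  Star = StarAdj pairs J

  -- `from` is an isomorphism onto the joined matching: the edges inside copies
  -- are the matching edges of G − x, the edges at x are recorded by J.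

  adj-from : ∀ a b → (Adj G (from a) (from b) → Star a b) × (Star a b → Adj G (from a) (from b))
  adj-from nothing  nothing  = irrefl G , λ ()
  adj-from nothing  (just _) = fromWitness , toWitness
  adj-from (just _) nothing  = (λ adj → fromWitness (sym G adj)) , (λ s → sym G (toWitness s))
  adj-from (just (i , b)) (just (j , c)) = matched-copy , copy-matched
    where
      matched-copy : Adj G (P (unlabel (i , b))) (P (unlabel (j , c))) → Star (just (i , b)) (just (j , c))
      matched-copy adj with partner-label (i , b) (j , c) (partner-unique _ _ adj)
      ... | refl = refl , refl
      copy-matched : Star (just (i , b)) (just (j , c)) → Adj G (P (unlabel (i , b))) (P (unlabel (j , c)))
      copy-matched (refl , refl) =
        subst (λ j → Adj G (P (unlabel (i , b))) (P j)) (≡-sym (unlabel-opposite (i , b))) (partner-adj _)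

  φ : Fin (suc m) ⤖ Maybe (Fin pairs × Bool)
  φ = ↔⇒⤖ (mk↔ₛ′ to from to-from from-to)

  adjacency : ∀ u v → (Adj G u v → Star (to u) (to v)) × (Star (to u) (to v) → Adj G u v)
  adjacency u v = subst₂ (λ a b → (Adj G a b → Star (to u) (to v)) × (Star (to u) (to v) → Adj G a b))
                         (from-to u) (from-to v) (adj-from (to u) (to v))

  -- In a connected G, a walk from copy l to x leaves copy l; as G − x matches
  -- the copy only with itself, the leaving edge goes to x.
  joins : Connected G → JoinsEach pairs J
  joins connected l =
    let (a , c , a∈copy , c∉copy , ac) = walk-exits G in-copy? (connected (endpoint false) x)
                                            (inj₁ refl) x∉copy
    in edge-to-x (to c) a∈copy (subst (λ v → ¬ InCopy v) (≡-sym (from-to c)) c∉copy)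
                 (subst (Adj G a) (≡-sym (from-to c)) ac)
    where
      endpoint : Bool → Fin (suc m)
      endpoint b = from (just (l , b))
      InCopy : Fin (suc m) → Set
      InCopy v = v ≡ endpoint false ⊎ v ≡ endpoint true
      in-copy? : ∀ v → Dec (InCopy v)
      in-copy? v = (v ≟ endpoint false) ⊎-dec (v ≟ endpoint true)
      x∉copy : ¬ InCopy x
      x∉copy (inj₁ x≡) = P≢x _ (≡-sym x≡)
      x∉copy (inj₂ x≡) = P≢x _ (≡-sym x≡)
      other-endpoint : ∀ b → InCopy (endpoint (not b))
      other-endpoint false = inj₂ refl
      other-endpoint true  = inj₁ refl
      leave-copy : ∀ b y → ¬ InCopy (from y) → Adj G (endpoint b) (from y) → ∃[ b ] T (J l b)
      leave-copy b nothing _ adj = b , fromWitness (sym G adj)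
      leave-copy b (just y) y∉copy adj with proj₁ (adj-from (just (l , b)) (just y)) adj
      ... | refl , refl = ⊥-elim (y∉copy (other-endpoint b))
      edge-to-x : ∀ {a} y → InCopy a → ¬ InCopy (from y) → Adj G a (from y) → ∃[ b ] T (J l b)
      edge-to-x y (inj₁ refl) = leave-copy false y
      edge-to-x y (inj₂ refl) = leave-copy true y

matching⇒joined : ∀ {m} (G : Graph (suc m)) → Connected G → (x : Fin (suc m)) →
  PerfectMatchingMinus G x → ∃[ k ] (m ≡ k + k × IsJoinedMatching G k)
matching⇒joined G connected x matching =
  pairs , size , J , joins connected , φ , adjacency
  where open MatchingPlusVertex G x matching

joined⇒matching : ∀ {n} (G : Graph n) {k} → IsJoinedMatching G k → ∃[ c ] PerfectMatchingMinus G c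
joined⇒matching {n} G {k} (J , _ , φ , iso) = c , matching
  where
    open Bijection φ using (to; injective; strictlySurjective)
    Star : Maybe (Fin k × Bool) → Maybe (Fin k × Bool) → Set
    Star = StarAdj k J

    vertex : Maybe (Fin k × Bool) → Fin n
    vertex y = proj₁ (strictlySurjective y)
    to-vertex : ∀ y → to (vertex y) ≡ y
    to-vertex y = proj₂ (strictlySurjective y)

    c : Fin n
    c = vertex nothing

    ≢c : ∀ {v y} → to v ≡ just y → v ≢ c
    ≢c eq refl with trans (≡-sym eq) (to-vertex nothing)
    ... | ()

    nothing⇒c : ∀ {v} → to v ≡ nothing → v ≡ c
    nothing⇒c eq = injective (trans eq (≡-sym (to-vertex nothing)))

    star⇒adj : ∀ {u v a b} → to u ≡ a → to v ≡ b → Star a b → Adj G u v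
    star⇒adj {u} {v} refl refl = proj₂ (iso u v)

    matched : ∀ v i b → to v ≡ just (i , b) →
      ∃[ u ] (u ≢ c × Adj G v u × ∀ w → w ≢ c → Adj G v w → w ≡ u)
    matched v i b to-v = u , ≢c (to-vertex _) , star⇒adj to-v (to-vertex _) (refl , refl) , only
      where
        u : Fin n
        u = vertex (just (i , not b))
        only : ∀ w → w ≢ c → Adj G v w → w ≡ u
        only w w≢c adj with to w in to-w | subst₂ Star to-v refl (proj₁ (iso v w) adj)
        ... | nothing | _ = ⊥-elim (w≢c (nothing⇒c to-w))
        ... | just (j , d) | refl , refl = injective (trans to-w (≡-sym (to-vertex _)))

    matching : PerfectMatchingMinus G c
    matching v v≢c with to v in to-v
    ... | nothing    = ⊥-elim (v≢c (nothing⇒c to-v))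
    ... | just (i , b) = matched v i b to-v

-- Lemma D: if G − x is a perfect matching and x has a neighbour, then V ∖ {x}
-- is an MTDS (each vertex is the private neighbour of its partner), and it
-- has the largest possible size n - 1.
matching⇒Γₜ : ∀ {m} (G : Graph (suc m)) (x : Fin (suc m)) → PerfectMatchingMinus G x →
  ∃[ w ] Adj G x w → UpperTotalDomNumberIs G m
matching⇒Γₜ {m} G x matching (w , xw) =
  (V∖x , (tds , private⇒minimal G has-private) , ∣∁⁅x⁆∣ x) ,
  mtds-size-bound G tds (x , λ x∈ → ∈∁⁅⁆⇒≢ x∈ refl)
  where
    V∖x : Subset (suc m)
    V∖x = ∁ ⁅ x ⁆

    tds : IsTDS G V∖x
    tds v with v ≟ x
    ... | yes refl = w , ≢⇒∈∁⁅⁆ (λ { refl → irrefl G xw }) , xw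
    ... | no v≢x   = let (u , u≢x , vu , _) = matching v v≢x in u , ≢⇒∈∁⁅⁆ u≢x , vu

    has-private : ∀ {v} → v ∈ V∖x → ∃[ u ] PrivateNeighbour G V∖x v u
    has-private {v} v∈ =
      let v≢x = ∈∁⁅⁆⇒≢ v∈
          (u , u≢x , vu , _) = matching v v≢x
          (_ , _ , _ , u-only) = matching u u≢x
      in u , sym G vu , λ y y∈ uy → trans (u-only y (∈∁⁅⁆⇒≢ y∈) uy)
                                          (≡-sym (u-only v v≢x (sym G vu)))

half-of-double : ∀ {m k} → m ≡ k + k → m / 2 ≡ k
half-of-double {k = k} refl = trans (cong (_/ 2) double) (m*n/n≡m k 2)
  where
    double : k + k ≡ k * 2
    double = ≡-sym (trans (*-suc k 1) (cong (k +_) (*-identityʳ k)))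

proposition1p6 : (n : ℕ) → 3 ≤ n → (G : Graph n) → Connected G →
    UpperTotalDomNumberIs G (n ∸ 1) ⇔
      (Odd n × IsJoinedMatching G ((n ∸ 1) / 2))
proposition1p6 (suc m@(suc (suc _))) (s≤s (s≤s (s≤s z≤n))) G connected = mk⇔ forward backward
  where
    forward : UpperTotalDomNumberIs G m → Odd (suc m) × IsJoinedMatching G (m / 2)
    forward ((S , mtds , size) , _) =
      let (x , matching)        = large-mtds⇒matching G S mtds size
          (k , m≡k+k , joined)  = matching⇒joined G connected x matching
      in (k , cong suc m≡k+k) , subst (IsJoinedMatching G) (≡-sym (half-of-double m≡k+k)) joined

    backward : Odd (suc m) × IsJoinedMatching G (m / 2) → UpperTotalDomNumberIs G m
    backward (_ , joined) =
      let (x , matching) = joined⇒matching G joined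
          x-has-neighbour = connected⇒neighbour G connected x (punchIn x zero) (punchInᵢ≢i x zero)
      in matching⇒Γₜ G x matching x-has-neighbour
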